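{- Let $p$ be an integer with $p>1$, and let $G$ be a connected $\{K_{1,3},B_{1,p}\}$-free graph which contains an induced cycle $C_k$ with $k\geq 2p+3$. Then $G$ is an inflation of $C_k$.
   Context: All graphs are finite and simple; $\mathcal H$-free means containing no graph of $\mathcal H$ as an induced subgraph. $K_{1,3}$ is the claw. $B_{i,j}$ is the graph obtained from a triangle and two vertex-disjoint paths $P_{i+1}$ and $P_{j+1}$ (paths on $i+1$ and $j+1$ vertices) by identifying one end-vertex of each path with two distinct vertices of the triangle, respectively. A graph is an inflation of $C_k$ if it can be obtained from the cycle $C_k$ by applying, in sequence, any number (possibly zero) of times the operation: choose a vertex $v$ of the current graph and add a new vertex adjacent precisely to $v$ and to all neighbours of $v$. -}

module Defs where

open import Data.Nat using (ℕ; zero; suc; _≡ᵇ_; _<ᵇ_; _≤ᵇ_)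
import Data.Nat as N
open import Data.Bool using (Bool; true; false; T; _∨_; _∧_)
open import Data.Bool.Properties using (T?)
open import Data.Fin using (Fin; zero; suc; toℕ)
open import Data.Fin.Properties using () renaming (_≟_ to _≟F_)
open import Data.Empty using (⊥)
open import Data.Sum using (_⊎_; inj₁; inj₂; swap)
open import Data.Product using (_×_; _,_; Σ; proj₁; proj₂)
open import Relation.Nullary using (¬_; Dec; yes; no)
open import Relation.Nullary.Decidable using (_×-dec_; _⊎-dec_; ¬?)
open import Relation.Binary.PropositionalEquality using (_≡_; _≢_; refl; sym; cong)
open import Relation.Binary.Construct.Closure.ReflexiveTransitive using (Star)
open import Function.Bundles using (_↔_; Inverse)
open import Function using (_⇔_)

record Graph : Set₁ where
  field
    n      : ℕ
    Adj    : Fin n → Fin n → Set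
    adjSym : ∀ {u v} → Adj u v → Adj v u
    irrefl : ∀ {u} → ¬ Adj u u
    dec    : ∀ u v → Dec (Adj u v)

open Graph public

Connected : Graph → Set
Connected G = ∀ (u v : Fin (n G)) → Star (Adj G) u v

record _≅_ (G H : Graph) : Set where
  field
    bij : Fin (n G) ↔ Fin (n H)
    adj : ∀ u v → Adj G u v ⇔ Adj H (Inverse.to bij u) (Inverse.to bij v)

record _⊑ᵢ_ (H G : Graph) : Set where
  field
    f    : Fin (n H) → Fin (n G)
    inj  : ∀ u v → f u ≡ f v → u ≡ v
    adj  : ∀ u v → Adj H u v ⇔ Adj G (f u) (f v)

_Free_ : Graph → Graph → Set
G Free H = ¬ (H ⊑ᵢ G)

mkGraph : (m : ℕ) → (ℕ → ℕ → Bool) → Graph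
mkGraph m E = record
  { n      = m
  ; Adj    = A
  ; adjSym = λ { (ne , e) → (λ eq → ne (sym eq)) , swap e }
  ; irrefl = λ { (ne , _) → ne refl }
  ; dec    = λ u v → ¬? (u ≟F v) ×-dec (T? (E (toℕ u) (toℕ v)) ⊎-dec T? (E (toℕ v) (toℕ u)))
  }
  where
  A : Fin m → Fin m → Set
  A u v = u ≢ v × (T (E (toℕ u) (toℕ v)) ⊎ T (E (toℕ v) (toℕ u)))

-- The cycle C_k on vertices 0,…,k-1: i ~ i+1 and k-1 ~ 0
-- (a genuine cycle for k ≥ 3).
cycleEdge : ℕ → ℕ → ℕ → Bool
cycleEdge k a b = (suc a ≡ᵇ b) ∨ ((a ≡ᵇ 0) ∧ (suc b ≡ᵇ k))

Cycle : ℕ → Graph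
Cycle k = mkGraph k (cycleEdge k)

Claw : Graph
Claw = mkGraph 4 (λ a b → a ≡ᵇ 0)

-- B_{1,p}: triangle {0,1,2}; path P_2 = 0–3 attached at 0;
-- path P_{p+1} = 1–4–5–…–(p+3) attached at 1.  (p+4 vertices.)
bEdge : ℕ → ℕ → Bool
bEdge a b = ((a <ᵇ 3) ∧ (b <ᵇ 3))
          ∨ ((a ≡ᵇ 0) ∧ (b ≡ᵇ 3))
          ∨ ((a ≡ᵇ 1) ∧ (b ≡ᵇ 4))
          ∨ ((4 ≤ᵇ a) ∧ (suc a ≡ᵇ b))

B1 : ℕ → Graph
B1 p = mkGraph (p N.+ 4) bEdge


-- The inflation operation: add a new vertex (vertex zero) adjacent
-- precisely to v and to all neighbours of v (old vertices are suc i).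

module _ (G : Graph) (v : Fin (n G)) where
  private
    A : Fin (suc (n G)) → Fin (suc (n G)) → Set
    A zero    zero    = ⊥
    A zero    (suc j) = j ≡ v ⊎ Adj G v j
    A (suc i) zero    = i ≡ v ⊎ Adj G v i
    A (suc i) (suc j) = Adj G i j

    symA : ∀ {x y} → A x y → A y x
    symA {zero}  {zero}  ()
    symA {zero}  {suc j} a = a
    symA {suc i} {zero}  a = a
    symA {suc i} {suc j} a = Graph.adjSym G a

    irreflA : ∀ {x} → ¬ A x x
    irreflA {zero}  ()
    irreflA {suc i} a = Graph.irrefl G a

    decA : ∀ x y → Dec (A x y)
    decA zero    zero    = no (λ ())
    decA zero    (suc j) = (j ≟F v) ⊎-dec Graph.dec G v j
    decA (suc i) zero    = (i ≟F v) ⊎-dec Graph.dec G v i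
    decA (suc i) (suc j) = Graph.dec G i j

  addTwin : Graph
  addTwin = record { n = suc (n G) ; Adj = A ; adjSym = λ {x} {y} → symA {x} {y} ; irrefl = λ {x} → irreflA {x} ; dec = decA }

data InflationOf (C : Graph) : Graph → Set₁ where
  base : ∀ {G} → C ≅ G → InflationOf C G
  step : ∀ {H G} → InflationOf C H → (v : Fin (n H)) → addTwin H v ≅ G → InflationOf C G

module Submission where

-- Induction on the number of vertices. If the induced cycle C is not all of G,
-- connectivity gives a vertex x ∉ C adjacent to C. Since C is long enough to carry
-- the path of a B₁,ₚ, claw-freeness and B₁,ₚ-freeness force the neighbours of x on C
-- to be three consecutive vertices c₀ c₁ c₂, and then x is a true twin of c₁: a vertex
-- outside C adjacent to exactly one of them yields a claw or an induced B₁,ₚ.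
-- Hence G arises from G - x by adding a twin of c₁, and G - x again satisfies all
-- hypotheses.

open import Defs
open import Data.Bool using (T)
open import Data.Bool.Properties using (T-∨; T-∧)
open import Data.Empty using (⊥; ⊥-elim)
open import Data.Fin using (Fin; toℕ; fromℕ<; punchIn; punchOut) renaming (zero to fz; suc to fs)
import Data.Fin.Properties as Finₚ
open import Data.Nat using (ℕ; zero; suc; _+_; _*_; _<_; _≤_; _≥_; z≤n; s≤s; _≤ᵇ_; _≡ᵇ_)
import Data.Nat as ℕ
open import Data.Nat.DivMod using (_%_; _/_; m%n<n; m<n⇒m%n≡m; %-distribˡ-+; [m+n]%n≡m%n; m≡m%n+[m/n]*n)
import Data.Nat.Properties as ℕₚ
open import Algebra.Properties.CommutativeSemigroup ℕₚ.+-commutativeSemigroup using (x∙yz≈y∙xz; xy∙z≈xz∙y)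
open import Data.Nat.Tactic.RingSolver using (solve-∀)
open import Data.Product using (_×_; _,_; Σ; proj₁; proj₂)
open import Data.Sum using (_⊎_; inj₁; inj₂; swap; [_,_]′)
open import Data.Unit using (tt)
open import Function.Bundles using (_⇔_; mk⇔; Equivalence; mk↔ₛ′)
import Function.Properties.Equivalence as ⇔
open import Relation.Binary using (tri<; tri≈; tri>)
open import Relation.Binary.Construct.Closure.ReflexiveTransitive using (Star; ε; _◅_; _◅◅_)
open import Relation.Binary.PropositionalEquality
  using (_≡_; _≢_; refl; sym; trans; cong; subst; subst₂; module ≡-Reasoning)
open import Relation.Nullary using (¬_; Dec; yes; no; _¬-⊎_)

≤-lit : ∀ {m n} {_ : T (m ≤ᵇ n)} → m ≤ n
≤-lit {m} {n} {t} = ℕₚ.≤ᵇ⇒≤ m n t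

⇔-inhabited : ∀ {A B : Set} → A → B → A ⇔ B
⇔-inhabited a b = mk⇔ (λ _ → b) (λ _ → a)

⇔-empty : ∀ {A B : Set} → ¬ A → ¬ B → A ⇔ B
⇔-empty ¬a ¬b = mk⇔ (λ a → ⊥-elim (¬a a)) (λ b → ⊥-elim (¬b b))

⇔-drop-fst : ∀ {A B C : Set} → A → B ⇔ C → (A × B) ⇔ C
⇔-drop-fst a e = mk⇔ (λ ab → Equivalence.to e (proj₂ ab)) (λ c → a , Equivalence.from e c)


module GraphFacts (G : Graph) where

  V : Set
  V = Fin (n G)

  infix 4 _~_ _≁_
  _~_ _≁_ : V → V → Set
  _~_ = Adj G
  u ≁ v = ¬ (u ~ v)

  ~-sym : ∀ {u v} → u ~ v → v ~ u
  ~-sym = adjSym G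

  ≁-sym : ∀ {u v} → u ≁ v → v ≁ u
  ≁-sym u≁v v~u = u≁v (~-sym v~u)

  ~⇒≢ : ∀ {u v} → u ~ v → u ≢ v
  ~⇒≢ u~v refl = irrefl G u~v

  separated⇒≢ : ∀ {w u v} → w ~ u → w ≁ v → u ≢ v
  separated⇒≢ w~u w≁v refl = w≁v w~u

  record Twins (x v : V) : Set where
    field
      x≢v : x ≢ v
      x~v : x ~ v
      same-neighbours : ∀ w → w ≢ x → w ≢ v → x ~ w ⇔ v ~ w

  edge : ∀ {u v} {X : Set} → X → u ~ v → u ≢ v × (X ⇔ u ~ v)
  edge x e = ~⇒≢ e , ⇔-inhabited x e

  non-edge : ∀ {u v} → u ≢ v → u ≁ v → u ≢ v × ((⊥ ⊎ ⊥) ⇔ u ~ v)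
  non-edge u≢v ne = u≢v , ⇔-empty (⊥-elim ¬-⊎ ⊥-elim) ne

  mkGraph⊑ : ∀ m E (h : ℕ → V)
    → (∀ a b → a < b → b < m → h a ≢ h b × ((T (E a b) ⊎ T (E b a)) ⇔ h a ~ h b))
    → mkGraph m E ⊑ᵢ G
  mkGraph⊑ m E h pairs = record { f = λ u → h (toℕ u) ; inj = inj ; adj = adj }
    where
    inj : ∀ u v → h (toℕ u) ≡ h (toℕ v) → u ≡ v
    inj u v eq with ℕₚ.<-cmp (toℕ u) (toℕ v)
    ... | tri< lt _ _ = ⊥-elim (proj₁ (pairs _ _ lt (Finₚ.toℕ<n v)) eq)
    ... | tri≈ _ eq′ _ = Finₚ.toℕ-injective eq′
    ... | tri> _ _ gt = ⊥-elim (proj₁ (pairs _ _ gt (Finₚ.toℕ<n u)) (sym eq))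
    adj : ∀ u v → Adj (mkGraph m E) u v ⇔ h (toℕ u) ~ h (toℕ v)
    adj u v with ℕₚ.<-cmp (toℕ u) (toℕ v)
    ... | tri< lt _ _ = ⇔-drop-fst (λ e → ℕₚ.<⇒≢ lt (cong toℕ e)) (proj₂ (pairs _ _ lt (Finₚ.toℕ<n v)))
    ... | tri> _ _ gt = ⇔-drop-fst (λ e → ℕₚ.<⇒≢ gt (cong toℕ (sym e)))
                              (⇔.trans (mk⇔ swap swap)
                                       (⇔.trans (proj₂ (pairs _ _ gt (Finₚ.toℕ<n u))) (mk⇔ ~-sym ~-sym)))
    ... | tri≈ _ eq _ with Finₚ.toℕ-injective {i = u} {j = v} eq
    ...   | refl = ⇔-empty (λ e → proj₁ e refl) (irrefl G)

  claw⊑ : ∀ {z a b c} → z ~ a → z ~ b → z ~ c → a ≁ b → a ≁ c → b ≁ c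
        → a ≢ b → a ≢ c → b ≢ c → Claw ⊑ᵢ G
  claw⊑ {z} {a} {b} {c} za zb zc ab ac bc a≢b a≢c b≢c = mkGraph⊑ 4 _ h pairs
    where
    h : ℕ → V
    h 0 = z
    h 1 = a
    h 2 = b
    h _ = c
    pairs : ∀ i j → i < j → j < 4 → h i ≢ h j × ((T (i ≡ᵇ 0) ⊎ T (j ≡ᵇ 0)) ⇔ h i ~ h j)
    pairs 0 1 _ _ = edge (inj₁ tt) za
    pairs 0 2 _ _ = edge (inj₁ tt) zb
    pairs 0 3 _ _ = edge (inj₁ tt) zc
    pairs 1 2 _ _ = non-edge a≢b ab
    pairs 1 3 _ _ = non-edge a≢c ac
    pairs 2 3 _ _ = non-edge b≢c bc
    pairs (suc i) 1 (s≤s ()) _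
    pairs (suc (suc i)) 2 (s≤s (s≤s ())) _
    pairs (suc (suc (suc i))) 3 (s≤s (s≤s (s≤s ()))) _
    pairs i (suc (suc (suc (suc j)))) _ (s≤s (s≤s (s≤s (s≤s ()))))

  record InducedB1 (p : ℕ) : Set where
    field
      t₀ t₁ t₂ q : V
      path : ℕ → V
      t₀~t₁ : t₀ ~ t₁
      t₀~t₂ : t₀ ~ t₂
      t₁~t₂ : t₁ ~ t₂
      t₀~q : t₀ ~ q
      t₁~path : t₁ ~ path 0
      path~path : ∀ s → suc s < p → path s ~ path (suc s)
      q≁t₁ : q ≁ t₁
      q≁t₂ : q ≁ t₂
      q≁path : ∀ s → s < p → q ≁ path s
      t₀≁path : ∀ s → s < p → t₀ ≁ path s
      t₂≁path : ∀ s → s < p → t₂ ≁ path s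
      t₁≁path : ∀ s → suc s < p → t₁ ≁ path (suc s)
      path-induced : ∀ s t → suc s < t → t < p → path s ≁ path t

  B1⊑ : ∀ {p} → InducedB1 p → B1 p ⊑ᵢ G
  B1⊑ {p} β = mkGraph⊑ (p + 4) bEdge h pairs
    where
    open InducedB1 β
    h : ℕ → V
    h 0 = t₀
    h 1 = t₁
    h 2 = t₂
    h 3 = q
    h (suc (suc (suc (suc s)))) = path s

    onPath : ∀ {s} → 4 + s < p + 4 → s < p
    onPath {s} lt = ℕₚ.+-cancelˡ-< 4 s p (subst (4 + s <_) (ℕₚ.+-comm p 4) lt)

    path≢path : ∀ {s t} → suc s < t → t < p → path s ≢ path t
    path≢path {zero} {suc t} _ t<p = separated⇒≢ t₁~path (t₁≁path t t<p)
    path≢path {suc r} {t} r+3≤t t<p = separated⇒≢ (path~path r (ℕₚ.<-trans r+2<t t<p)) (path-induced r t r+2<t t<p)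
      where
      r+2<t : suc r < t
      r+2<t = ℕₚ.<-trans (ℕₚ.n<1+n _) r+3≤t

    pairs : ∀ a b → a < b → b < p + 4 → h a ≢ h b × ((T (bEdge a b) ⊎ T (bEdge b a)) ⇔ h a ~ h b)
    pairs 0 1 _ _ = edge (inj₁ tt) t₀~t₁
    pairs 0 2 _ _ = edge (inj₁ tt) t₀~t₂
    pairs 0 3 _ _ = edge (inj₁ tt) t₀~q
    pairs 0 (suc (suc (suc (suc s)))) _ b< =
      non-edge (separated⇒≢ (~-sym t₀~q) (q≁path s (onPath b<))) (t₀≁path s (onPath b<))
    pairs 1 2 _ _ = edge (inj₁ tt) t₁~t₂
    pairs 1 3 _ _ = non-edge (separated⇒≢ (~-sym t₁~t₂) (≁-sym q≁t₂)) (≁-sym q≁t₁)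
    pairs 1 4 _ _ = edge (inj₁ tt) t₁~path
    pairs 1 (suc (suc (suc (suc (suc s))))) _ b< =
      non-edge (separated⇒≢ t₀~t₁ (t₀≁path (suc s) (onPath b<))) (t₁≁path s (onPath b<))
    pairs 2 3 _ _ = non-edge (separated⇒≢ t₁~t₂ (≁-sym q≁t₁)) (≁-sym q≁t₂)
    pairs 2 (suc (suc (suc (suc s)))) _ b< =
      non-edge (separated⇒≢ t₀~t₂ (t₀≁path s (onPath b<))) (t₂≁path s (onPath b<))
    pairs 3 (suc (suc (suc (suc s)))) _ b< =
      non-edge (separated⇒≢ t₀~q (t₀≁path s (onPath b<))) (q≁path s (onPath b<))
    pairs (suc (suc (suc (suc s)))) (suc (suc (suc (suc t)))) a<b b< with suc s ℕ.≟ t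
    ... | yes refl = edge (inj₁ (ℕₚ.≡⇒≡ᵇ (suc s) (suc s) refl)) (path~path s (onPath b<))
    ... | no s+1≢t = path≢path s+2≤t (onPath b<) , ⇔-empty noLabel (path-induced s t s+2≤t (onPath b<))
      where
      s<t : s < t
      s<t = ℕ.s≤s⁻¹ (ℕ.s≤s⁻¹ (ℕ.s≤s⁻¹ (ℕ.s≤s⁻¹ a<b)))
      s+2≤t : suc s < t
      s+2≤t = ℕₚ.≤∧≢⇒< s<t s+1≢t
      noLabel : ¬ (T (suc s ≡ᵇ t) ⊎ T (suc t ≡ᵇ s))
      noLabel (inj₁ e) = s+1≢t (ℕₚ.≡ᵇ⇒≡ (suc s) t e)
      noLabel (inj₂ e) = ℕₚ.<-asym s<t (subst (t <_) (ℕₚ.≡ᵇ⇒≡ (suc t) s e) (ℕₚ.n<1+n t))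
    pairs (suc a) 1 (s≤s ()) _
    pairs (suc (suc a)) 2 (s≤s (s≤s ())) _
    pairs (suc (suc (suc a))) 3 (s≤s (s≤s (s≤s ()))) _

module _ {H G : Graph} (e : H ⊑ᵢ G) where
  open _⊑ᵢ_ e

  Image : Fin (n G) → Set
  Image w = Σ (Fin (n H)) (λ z → f z ≡ w)

  image? : ∀ w → Dec (Image w)
  image? w = Finₚ.any? (λ z → f z Finₚ.≟ w)

  ⊑ᵢ-onto⇒≅ : (∀ w → Image w) → H ≅ G
  ⊑ᵢ-onto⇒≅ onto = record
    { bij = mk↔ₛ′ f (λ w → proj₁ (onto w)) (λ w → proj₂ (onto w)) (λ z → inj _ _ (proj₂ (onto (f z))))
    ; adj = adj
    }

boundary-edge : ∀ (G : Graph) (P : Fin (n G) → Set) → (∀ w → Dec (P w))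
              → ∀ {a b} → Star (Adj G) a b → ¬ P a → P b
              → Σ (Fin (n G)) (λ y → ¬ P y × Σ (Fin (n G)) (λ u → P u × Adj G y u))
boundary-edge G P P? ε ¬Pa Pb = ⊥-elim (¬Pa Pb)
boundary-edge G P P? {a} (_◅_ {j = a₁} a~a₁ walk) ¬Pa Pb with P? a₁
... | yes Pa₁ = a , ¬Pa , a₁ , Pa₁ , a~a₁
... | no ¬Pa₁ = boundary-edge G P P? walk ¬Pa₁ Pb

onto-or-attached : ∀ {H G} (e : H ⊑ᵢ G) → Connected G → Fin (n H)
                 → (∀ w → Image e w)
                 ⊎ Σ (Fin (n G)) (λ x → ¬ Image e x × Σ (Fin (n H)) (λ z → Adj G x (_⊑ᵢ_.f e z)))
onto-or-attached {G = G} e conn z₀ with Finₚ.all? (image? e)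
... | yes onto = inj₁ onto
... | no ¬onto with Finₚ.¬∀⟶∃¬ (n G) (Image e) (image? e) ¬onto
...   | w , w∉e with boundary-edge G (Image e) (image? e) (conn w (_⊑ᵢ_.f e z₀)) w∉e (z₀ , refl)
...     | x , x∉e , _ , (z , refl) , x~z = inj₂ (x , x∉e , z , x~z)

-- punchIn and punchOut for Fin N with N not syntactically a successor.
private
  punchIn′ : ∀ {N} → Fin N → Fin (ℕ.pred N) → Fin N
  punchIn′ {suc _} = punchIn

  punchIn′-injective : ∀ {N} (x : Fin N) {i j} → punchIn′ x i ≡ punchIn′ x j → i ≡ j
  punchIn′-injective {suc _} x = Finₚ.punchIn-injective x _ _

  punchIn′≢ : ∀ {N} (x : Fin N) i → punchIn′ x i ≢ x
  punchIn′≢ {suc _} = Finₚ.punchInᵢ≢i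

  punchOut′ : ∀ {N} {x w : Fin N} → x ≢ w → Fin (ℕ.pred N)
  punchOut′ {suc _} = punchOut

  punchIn′-punchOut′ : ∀ {N} {x w : Fin N} (x≢w : x ≢ w) → punchIn′ x (punchOut′ x≢w) ≡ w
  punchIn′-punchOut′ {suc _} = Finₚ.punchIn-punchOut

deleteVertex : (G : Graph) → Fin (n G) → Graph
deleteVertex G x = record
  { n = ℕ.pred (n G)
  ; Adj = λ i j → Adj G (punchIn′ x i) (punchIn′ x j)
  ; adjSym = adjSym G
  ; irrefl = irrefl G
  ; dec = λ i j → dec G (punchIn′ x i) (punchIn′ x j)
  }

⊑ᵢ-deleteVertex : ∀ {H G} x → H ⊑ᵢ deleteVertex G x → H ⊑ᵢ G
⊑ᵢ-deleteVertex x e = record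
  { f = λ u → punchIn′ x (f u)
  ; inj = λ u v eq → inj u v (punchIn′-injective x eq)
  ; adj = adj
  }
  where open _⊑ᵢ_ e

Free-deleteVertex : ∀ {H G} x → G Free H → deleteVertex G x Free H
Free-deleteVertex x G-free H⊑G-x = G-free (⊑ᵢ-deleteVertex x H⊑G-x)

module DeleteTwin (G : Graph) {x v : Fin (n G)} (twins : GraphFacts.Twins G x v) where
  open GraphFacts G
  open Twins twins

  G-x : Graph
  G-x = deleteVertex G x

  v′ : Fin (n G-x)
  v′ = punchOut′ x≢v

  v′↦v : punchIn′ x v′ ≡ v
  v′↦v = punchIn′-punchOut′ x≢v

  collapse : V → Fin (n G-x)
  collapse w with x Finₚ.≟ w
  ... | yes _ = v′
  ... | no x≢w = punchOut′ x≢w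

  collapse-x : collapse x ≡ v′
  collapse-x with x Finₚ.≟ x
  ... | yes _ = refl
  ... | no x≢x = ⊥-elim (x≢x refl)

  punchIn-collapse : ∀ w → w ≢ x → punchIn′ x (collapse w) ≡ w
  punchIn-collapse w w≢x with x Finₚ.≟ w
  ... | yes x≡w = ⊥-elim (w≢x (sym x≡w))
  ... | no x≢w = punchIn′-punchOut′ x≢w

  collapse-punchIn : ∀ i → collapse (punchIn′ x i) ≡ i
  collapse-punchIn i = punchIn′-injective x (punchIn-collapse (punchIn′ x i) (punchIn′≢ x i))

  collapse-v : collapse v ≡ v′
  collapse-v = punchIn′-injective x (trans (punchIn-collapse v (λ e → x≢v (sym e))) (sym v′↦v))

  twin~ : ∀ {w} → w ≢ x → w ≢ v → x ~ w → v ~ w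
  twin~ w≢x w≢v = Equivalence.to (same-neighbours _ w≢x w≢v)

  ~twin : ∀ {w} → w ≢ x → w ≢ v → v ~ w → x ~ w
  ~twin w≢x w≢v = Equivalence.from (same-neighbours _ w≢x w≢v)

  -- An edge x w is replaced by the edge v w, or vanishes if w = v.
  collapse-edge : ∀ {a b} → a ~ b → Star (Adj G-x) (collapse a) (collapse b)
  collapse-edge {a} {b} a~b with a Finₚ.≟ x | b Finₚ.≟ x
  ... | yes refl | yes refl = ⊥-elim (irrefl G a~b)
  ... | yes refl | no b≢x with b Finₚ.≟ v
  ...   | yes refl = subst₂ (Star (Adj G-x)) (sym collapse-x) (sym collapse-v) ε
  ...   | no b≢v = subst (λ i → Star (Adj G-x) i (collapse b)) (sym collapse-x)
                     (subst₂ _~_ (sym v′↦v) (sym (punchIn-collapse b b≢x)) (twin~ b≢x b≢v a~b) ◅ ε)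
  collapse-edge {a} {b} a~b | no a≢x | yes refl with a Finₚ.≟ v
  ...   | yes refl = subst₂ (Star (Adj G-x)) (sym collapse-v) (sym collapse-x) ε
  ...   | no a≢v = subst (Star (Adj G-x) (collapse a)) (sym collapse-x)
                     (subst₂ _~_ (sym (punchIn-collapse a a≢x)) (sym v′↦v) (~-sym (twin~ a≢x a≢v (~-sym a~b))) ◅ ε)
  collapse-edge {a} {b} a~b | no a≢x | no b≢x =
    subst₂ _~_ (sym (punchIn-collapse a a≢x)) (sym (punchIn-collapse b b≢x)) a~b ◅ ε

  collapse-walk : ∀ {a b} → Star _~_ a b → Star (Adj G-x) (collapse a) (collapse b)
  collapse-walk ε = ε
  collapse-walk (e ◅ es) = collapse-edge e ◅◅ collapse-walk es

  connected : Connected G → Connected G-x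
  connected conn i j = subst₂ (Star (Adj G-x)) (collapse-punchIn i) (collapse-punchIn j)
                         (collapse-walk (conn (punchIn′ x i) (punchIn′ x j)))

  ⊑ᵢ-avoiding : ∀ {H} (e : H ⊑ᵢ G) → ¬ Image e x → H ⊑ᵢ G-x
  ⊑ᵢ-avoiding {H} e x∉e = record { f = λ z → collapse (f z) ; inj = inj′ ; adj = adj′ }
    where
    open _⊑ᵢ_ e
    restore : ∀ z → punchIn′ x (collapse (f z)) ≡ f z
    restore z = punchIn-collapse (f z) (λ fz≡x → x∉e (z , fz≡x))
    inj′ : ∀ a b → collapse (f a) ≡ collapse (f b) → a ≡ b
    inj′ a b eq = inj a b (trans (sym (restore a)) (trans (cong (punchIn′ x) eq) (restore b)))
    adj′ : ∀ a b → Adj H a b ⇔ punchIn′ x (collapse (f a)) ~ punchIn′ x (collapse (f b))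
    adj′ a b = mk⇔ (λ h → subst₂ _~_ (sym (restore a)) (sym (restore b)) (Equivalence.to (adj a b) h))
                   (λ h → Equivalence.from (adj a b) (subst₂ _~_ (restore a) (restore b) h))

  x-neighbourhood : ∀ j → (j ≡ v′ ⊎ Adj G-x v′ j) ⇔ x ~ punchIn′ x j
  x-neighbourhood j = mk⇔ fw bw
    where
    fw : j ≡ v′ ⊎ Adj G-x v′ j → x ~ punchIn′ x j
    fw (inj₁ refl) = subst (x ~_) (sym v′↦v) x~v
    fw (inj₂ v′~j) with punchIn′ x j Finₚ.≟ v
    ... | yes j↦v = subst (x ~_) (sym j↦v) x~v
    ... | no j≢v = ~twin (punchIn′≢ x j) j≢v (subst (_~ punchIn′ x j) v′↦v v′~j)
    bw : x ~ punchIn′ x j → j ≡ v′ ⊎ Adj G-x v′ j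
    bw x~j with j Finₚ.≟ v′
    ... | yes j≡v′ = inj₁ j≡v′
    ... | no j≢v′ = inj₂ (subst (_~ punchIn′ x j) (sym v′↦v)
                     (twin~ (punchIn′≢ x j) (λ e → j≢v′ (punchIn′-injective x (trans e (sym v′↦v)))) x~j))

  addTwin≅ : addTwin G-x v′ ≅ G
  addTwin≅ = record { bij = mk↔ₛ′ to from to∘from from∘to ; adj = adj′ }
    where
    to : Fin (suc (n G-x)) → V
    to fz = x
    to (fs i) = punchIn′ x i
    from : V → Fin (suc (n G-x))
    from w with w Finₚ.≟ x
    ... | yes _ = fz
    ... | no _ = fs (collapse w)
    to∘from : ∀ w → to (from w) ≡ w
    to∘from w with w Finₚ.≟ x
    ... | yes w≡x = sym w≡x
    ... | no w≢x = punchIn-collapse w w≢x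
    from∘to : ∀ u → from (to u) ≡ u
    from∘to fz with x Finₚ.≟ x
    ... | yes _ = refl
    ... | no x≢x = ⊥-elim (x≢x refl)
    from∘to (fs i) with punchIn′ x i Finₚ.≟ x
    ... | yes eq = ⊥-elim (punchIn′≢ x i eq)
    ... | no _ = cong fs (collapse-punchIn i)
    adj′ : ∀ u w → Adj (addTwin G-x v′) u w ⇔ to u ~ to w
    adj′ fz fz = ⇔-empty (λ ()) (irrefl G)
    adj′ fz (fs j) = x-neighbourhood j
    adj′ (fs i) fz = ⇔.trans (x-neighbourhood i) (mk⇔ ~-sym ~-sym)
    adj′ (fs i) (fs j) = mk⇔ (λ h → h) (λ h → h)

-- An induced cycle of length K = suc K₁, as a K-periodic sequence of vertices, so that
-- rotating and reflecting the cycle are reindexings.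
module InducedCycle (G : Graph) (K₁ : ℕ) where
  open GraphFacts G

  K : ℕ
  K = suc K₁

  record IsInducedCycle (c : ℕ → V) : Set where
    field
      periodic : ∀ i → c (i + K) ≡ c i
      step~ : ∀ i → c i ~ c (suc i)
      chordless : ∀ i d → 2 ≤ d → 2 + d ≤ K → c i ≁ c (i + d)
      injective : ∀ i d → 1 ≤ d → d < K → c i ≢ c (i + d)

  module _ {c : ℕ → V} (cyc : IsInducedCycle c) where
    open IsInducedCycle cyc

    periodic* : ∀ i q → c (i + q * K) ≡ c i
    periodic* i zero = cong c (ℕₚ.+-identityʳ i)
    periodic* i (suc q) = begin
      c (i + (K + q * K)) ≡⟨ cong (λ j → c (i + j)) (ℕₚ.+-comm K (q * K)) ⟩
      c (i + (q * K + K)) ≡⟨ cong c (ℕₚ.+-assoc i (q * K) K) ⟨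
      c (i + q * K + K)   ≡⟨ periodic (i + q * K) ⟩
      c (i + q * K)       ≡⟨ periodic* i q ⟩
      c i                 ∎
      where open ≡-Reasoning

    nonadjacent : ∀ i j → 2 + i ≤ j → 2 + j ≤ i + K → c i ≁ c j
    nonadjacent i j 2+i≤j 2+j≤i+K with ℕₚ.m≤n⇒∃[o]m+o≡n (ℕₚ.≤-trans (ℕₚ.m≤n+m i 2) 2+i≤j)
    ... | d , refl = chordless i d (ℕₚ.+-cancelˡ-≤ i 2 d (subst (_≤ i + d) (ℕₚ.+-comm 2 i) 2+i≤j))
                                  (ℕₚ.+-cancelˡ-≤ i (2 + d) K (subst (_≤ i + K) (x∙yz≈y∙xz 2 i d) 2+j≤i+K))

    distinct : ∀ i j → i < j → j < i + K → c i ≢ c j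
    distinct i j i<j j<i+K with ℕₚ.m≤n⇒∃[o]m+o≡n (ℕₚ.<⇒≤ i<j)
    ... | d , refl = injective i d (ℕₚ.+-cancelˡ-≤ i 1 d (subst (_≤ i + d) (ℕₚ.+-comm 1 i) i<j))
                                   (ℕₚ.+-cancelˡ-< i d K j<i+K)

    predecessor~ : c 0 ~ c K₁
    predecessor~ = ~-sym (subst (c K₁ ~_) (periodic 0) (step~ K₁))

    wrap : ∀ i → c (suc i + K₁) ≡ c i
    wrap i = trans (cong c (sym (ℕₚ.+-suc i K₁))) (periodic i)

  rotate : ℕ → (ℕ → V) → ℕ → V
  rotate s c j = c (j + s)

  rotate-isInducedCycle : ∀ {c} s → IsInducedCycle c → IsInducedCycle (rotate s c)
  rotate-isInducedCycle {c} s cyc = record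
    { periodic = λ i → trans (cong c (swap-s i K)) (periodic (i + s))
    ; step~ = λ i → step~ (i + s)
    ; chordless = λ i d 2≤d 2+d≤K → subst (λ j → c (i + s) ≁ c j) (sym (swap-s i d)) (chordless (i + s) d 2≤d 2+d≤K)
    ; injective = λ i d 1≤d d<K → subst (λ j → c (i + s) ≢ c j) (sym (swap-s i d)) (injective (i + s) d 1≤d d<K)
    }
    where
    open IsInducedCycle cyc
    swap-s : ∀ i d → i + d + s ≡ i + s + d
    swap-s i d = xy∙z≈xz∙y i d s

  shift-back : ∀ {c} → IsInducedCycle c → IsInducedCycle (rotate K₁ c)
  shift-back = rotate-isInducedCycle K₁

  -- i * K₁ ≡ -i (mod K), so this reads the cycle backwards from m.
  reflect : ℕ → (ℕ → V) → ℕ → V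
  reflect m c i = c (m + i * K₁)

  reflect-backwards : ∀ {c} → IsInducedCycle c → ∀ m d₀ d′ → suc d₀ + d′ ≡ K
                    → ∀ i → reflect m c (i + suc d₀) ≡ c (m + i * K₁ + d′)
  reflect-backwards {c} cyc m d₀ d′ split i =
    trans (cong c (subst (λ k → m + (i + suc d₀) * k ≡ (m + i * k + d′) + d₀ * suc k)
                         (sym (ℕₚ.suc-injective (sym split))) (expand m i d₀ d′)))
          (periodic* cyc (m + i * K₁ + d′) d₀)
    where
    expand : ∀ m i d₀ d′ → m + (i + suc d₀) * (d₀ + d′) ≡ (m + i * (d₀ + d′) + d′) + d₀ * suc (d₀ + d′)
    expand = solve-∀

  reflect-isInducedCycle : ∀ {c} m → IsInducedCycle c → IsInducedCycle (reflect m c)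
  reflect-isInducedCycle {c} m cyc = record
    { periodic = periodic′ ; step~ = step~′ ; chordless = chordless′ ; injective = injective′ }
    where
    open IsInducedCycle cyc
    periodic′ : ∀ i → c (m + (i + K) * K₁) ≡ c (m + i * K₁)
    periodic′ i = trans (cong c (expand m i K₁)) (periodic* cyc (m + i * K₁) K₁)
      where
      expand : ∀ m i K₁ → m + (i + suc K₁) * K₁ ≡ (m + i * K₁) + K₁ * suc K₁
      expand = solve-∀
    step~′ : ∀ i → c (m + i * K₁) ~ c (m + suc i * K₁)
    step~′ i = subst (λ j → c (m + i * K₁) ~ c j) (sym (expand m i K₁))
                 (~-sym (subst (c (m + i * K₁ + K₁) ~_) (wrap cyc (m + i * K₁)) (step~ (m + i * K₁ + K₁))))
      where
      expand : ∀ m i K₁ → m + (K₁ + i * K₁) ≡ m + i * K₁ + K₁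
      expand = solve-∀
    chordless′ : ∀ i d → 2 ≤ d → 2 + d ≤ K → c (m + i * K₁) ≁ c (m + (i + d) * K₁)
    chordless′ i (suc d₀) 2≤d 2+d≤K with ℕₚ.m≤n⇒∃[o]m+o≡n (ℕₚ.≤-trans (ℕₚ.m≤n+m (suc d₀) 2) 2+d≤K)
    ... | d′ , d+d′≡K = subst (λ v → c (m + i * K₁) ≁ v) (sym (reflect-backwards cyc m d₀ d′ d+d′≡K i))
        (chordless (m + i * K₁) d′
          (ℕₚ.+-cancelˡ-≤ (suc d₀) 2 d′
            (subst (suc d₀ + 2 ≤_) (sym d+d′≡K) (subst (_≤ K) (ℕₚ.+-comm 2 (suc d₀)) 2+d≤K)))
          (subst (2 + d′ ≤_) d+d′≡K (ℕₚ.+-monoˡ-≤ d′ 2≤d)))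
    injective′ : ∀ i d → 1 ≤ d → d < K → c (m + i * K₁) ≢ c (m + (i + d) * K₁)
    injective′ i (suc d₀) _ d<K with ℕₚ.m≤n⇒∃[o]m+o≡n (ℕₚ.<⇒≤ d<K)
    ... | d′ , d+d′≡K = subst (λ v → c (m + i * K₁) ≢ v) (sym (reflect-backwards cyc m d₀ d′ d+d′≡K i))
        (injective (m + i * K₁) d′
          (ℕₚ.+-cancelˡ-≤ (suc d₀) 1 d′
            (subst (suc d₀ + 1 ≤_) (sym d+d′≡K) (subst (_≤ K) (ℕₚ.+-comm 1 (suc d₀)) d<K)))
          (subst (d′ <_) d+d′≡K (s≤s (ℕₚ.m≤n+m d′ d₀))))

module FromEmbedding (G : Graph) (K₁ : ℕ) (2≤K : 2 ≤ suc K₁) (e : Cycle (suc K₁) ⊑ᵢ G) where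
  open GraphFacts G
  open InducedCycle G K₁
  open _⊑ᵢ_ e

  CycleEdge : ℕ → ℕ → Set
  CycleEdge a b = suc a ≡ b ⊎ suc b ≡ a ⊎ (a ≡ 0 × suc b ≡ K) ⊎ (b ≡ 0 × suc a ≡ K)

  cycleEdge⇒ : ∀ a b → T (cycleEdge K a b) → suc a ≡ b ⊎ (a ≡ 0 × suc b ≡ K)
  cycleEdge⇒ a b t with Equivalence.to T-∨ t
  ... | inj₁ x = inj₁ (ℕₚ.≡ᵇ⇒≡ _ _ x)
  ... | inj₂ y with Equivalence.to T-∧ y
  ...   | y₁ , y₂ = inj₂ (ℕₚ.≡ᵇ⇒≡ _ _ y₁ , ℕₚ.≡ᵇ⇒≡ _ _ y₂)

  ⇒cycleEdge : ∀ a b → suc a ≡ b ⊎ (a ≡ 0 × suc b ≡ K) → T (cycleEdge K a b)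
  ⇒cycleEdge a b (inj₁ x) = Equivalence.from T-∨ (inj₁ (ℕₚ.≡⇒≡ᵇ _ _ x))
  ⇒cycleEdge a b (inj₂ (y₁ , y₂)) =
    Equivalence.from T-∨ (inj₂ (Equivalence.from T-∧ (ℕₚ.≡⇒≡ᵇ _ _ y₁ , ℕₚ.≡⇒≡ᵇ _ _ y₂)))

  Adj⇒CycleEdge : ∀ (u v : Fin K) → Adj (Cycle K) u v → CycleEdge (toℕ u) (toℕ v)
  Adj⇒CycleEdge u v (_ , inj₁ t) with cycleEdge⇒ _ _ t
  ... | inj₁ x = inj₁ x
  ... | inj₂ y = inj₂ (inj₂ (inj₁ y))
  Adj⇒CycleEdge u v (_ , inj₂ t) with cycleEdge⇒ _ _ t
  ... | inj₁ x = inj₂ (inj₁ x)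
  ... | inj₂ y = inj₂ (inj₂ (inj₂ y))

  CycleEdge⇒Adj : ∀ (u v : Fin K) → CycleEdge (toℕ u) (toℕ v) → Adj (Cycle K) u v
  CycleEdge⇒Adj u v edge = u≢v edge , labels edge
    where
    irreflexive : ∀ {a} → ¬ CycleEdge a a
    irreflexive (inj₁ x) = ℕₚ.1+n≢n x
    irreflexive (inj₂ (inj₁ x)) = ℕₚ.1+n≢n x
    irreflexive (inj₂ (inj₂ (inj₁ (refl , 1≡K)))) = ℕₚ.<-irrefl 1≡K 2≤K
    irreflexive (inj₂ (inj₂ (inj₂ (refl , 1≡K)))) = ℕₚ.<-irrefl 1≡K 2≤K
    u≢v : CycleEdge (toℕ u) (toℕ v) → u ≢ v
    u≢v edge refl = irreflexive edge
    labels : CycleEdge (toℕ u) (toℕ v) → T (cycleEdge K (toℕ u) (toℕ v)) ⊎ T (cycleEdge K (toℕ v) (toℕ u))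
    labels (inj₁ x) = inj₁ (⇒cycleEdge _ _ (inj₁ x))
    labels (inj₂ (inj₁ x)) = inj₂ (⇒cycleEdge _ _ (inj₁ x))
    labels (inj₂ (inj₂ (inj₁ y))) = inj₁ (⇒cycleEdge _ _ (inj₂ y))
    labels (inj₂ (inj₂ (inj₂ y))) = inj₂ (⇒cycleEdge _ _ (inj₂ y))

  [i+d]%K≡[i%K+d]%K : ∀ i d → d < K → (i + d) % K ≡ (i % K + d) % K
  [i+d]%K≡[i%K+d]%K i d d<K = trans (%-distribˡ-+ i d K) (cong (λ j → (i % K + j) % K) (m<n⇒m%n≡m d<K))

  +-%-cases : ∀ i d → d < K → (i % K + d < K × (i + d) % K ≡ i % K + d) ⊎ ((i + d) % K + K ≡ i % K + d)
  +-%-cases i d d<K with i % K + d ℕ.<? K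
  ... | yes lt = inj₁ (lt , trans ([i+d]%K≡[i%K+d]%K i d d<K) (m<n⇒m%n≡m lt))
  ... | no ≮ with ℕₚ.m≤n⇒∃[o]m+o≡n (ℕₚ.≮⇒≥ ≮)
  ...   | o , K+o≡ = inj₂ (trans (cong (_+ K) (trans ([i+d]%K≡[i%K+d]%K i d d<K) wrapped)) (trans (ℕₚ.+-comm o K) K+o≡))
    where
    o<K : o < K
    o<K = ℕₚ.+-cancelˡ-< K o K (subst (_< K + K) (sym K+o≡) (ℕₚ.+-mono-< (m%n<n i K) d<K))
    wrapped : (i % K + d) % K ≡ o
    wrapped = trans (cong (_% K) (trans (sym K+o≡) (ℕₚ.+-comm K o)))
                    (trans ([m+n]%n≡m%n o K) (m<n⇒m%n≡m o<K))

  index : ℕ → Fin K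
  index i = fromℕ< (m%n<n i K)

  cycle : ℕ → V
  cycle i = f (index i)

  toℕ-index : ∀ i → toℕ (index i) ≡ i % K
  toℕ-index i = Finₚ.toℕ-fromℕ< (m%n<n i K)

  cycle-toℕ : ∀ z → cycle (toℕ z) ≡ f z
  cycle-toℕ z = cong f (trans (Finₚ.fromℕ<-cong _ _ (m<n⇒m%n≡m (Finₚ.toℕ<n z)) _ (Finₚ.toℕ<n z))
                              (Finₚ.fromℕ<-toℕ z (Finₚ.toℕ<n z)))

  private
    CycleEdge% : ℕ → ℕ → Set
    CycleEdge% i j = CycleEdge (i % K) (j % K)

    CycleEdge⇒~ : ∀ i j → CycleEdge% i j → cycle i ~ cycle j
    CycleEdge⇒~ i j edge = Equivalence.to (adj (index i) (index j))
      (CycleEdge⇒Adj (index i) (index j) (subst₂ CycleEdge (sym (toℕ-index i)) (sym (toℕ-index j)) edge))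

    ~⇒CycleEdge : ∀ i j → cycle i ~ cycle j → CycleEdge% i j
    ~⇒CycleEdge i j i~j = subst₂ CycleEdge (toℕ-index i) (toℕ-index j)
      (Adj⇒CycleEdge (index i) (index j) (Equivalence.from (adj (index i) (index j)) i~j))

    ≡⇒%≡ : ∀ i j → cycle i ≡ cycle j → i % K ≡ j % K
    ≡⇒%≡ i j eq = trans (sym (toℕ-index i)) (trans (cong toℕ (inj (index i) (index j) eq)) (toℕ-index j))

    periodic : ∀ i → cycle (i + K) ≡ cycle i
    periodic i = cong f (Finₚ.fromℕ<-cong _ _ ([m+n]%n≡m%n i K) _ _)

    step~ : ∀ i → cycle i ~ cycle (suc i)
    step~ i = CycleEdge⇒~ i (suc i) (from-cases (subst Cases (ℕₚ.+-comm i 1) (+-%-cases i 1 2≤K)))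
      where
      Cases : ℕ → Set
      Cases j = (i % K + 1 < K × j % K ≡ i % K + 1) ⊎ (j % K + K ≡ i % K + 1)
      from-cases : Cases (suc i) → CycleEdge% i (suc i)
      from-cases (inj₁ (_ , eq)) = inj₁ (sym (trans eq (ℕₚ.+-comm (i % K) 1)))
      from-cases (inj₂ eq) = inj₂ (inj₂ (inj₂ (wraps-to-0 , trans (sym eq′) (cong (_+ K) wraps-to-0))))
        where
        eq′ : suc i % K + K ≡ suc (i % K)
        eq′ = trans eq (ℕₚ.+-comm (i % K) 1)
        wraps-to-0 : suc i % K ≡ 0
        wraps-to-0 = ℕₚ.n≤0⇒n≡0 (ℕₚ.+-cancelʳ-≤ K _ 0 (subst (_≤ K) (sym eq′) (m%n<n i K)))

    1≢d : ∀ {d} → 2 ≤ d → 1 ≢ d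
    1≢d (s≤s ()) refl

    shorter : ∀ {d} → 2 + d ≤ K → d < K
    shorter = ℕₚ.≤-trans (ℕₚ.n≤1+n _)

    spread⇒¬CycleEdge : ∀ a b d → 2 ≤ d → 2 + d ≤ K
      → (a + d < K × b ≡ a + d) ⊎ (b + K ≡ a + d) → ¬ CycleEdge a b
    spread⇒¬CycleEdge a b d 2≤d 2+d≤K (inj₁ (_ , refl)) (inj₁ 1+a≡a+d) =
      1≢d 2≤d (ℕₚ.+-cancelˡ-≡ a 1 d (trans (ℕₚ.+-comm a 1) 1+a≡a+d))
    spread⇒¬CycleEdge a b d 2≤d 2+d≤K (inj₁ (_ , refl)) (inj₂ (inj₁ 1+a+d≡a)) =
      ℕₚ.m≢1+m+n a (sym 1+a+d≡a)
    spread⇒¬CycleEdge a b d 2≤d 2+d≤K (inj₁ (_ , refl)) (inj₂ (inj₂ (inj₁ (refl , 1+d≡K)))) =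
      ℕₚ.1+n≰n (subst (2 + d ≤_) (sym 1+d≡K) 2+d≤K)
    spread⇒¬CycleEdge a b d 2≤d 2+d≤K (inj₁ (_ , refl)) (inj₂ (inj₂ (inj₂ (a+d≡0 , _)))) =
      ℕₚ.<-irrefl refl (ℕₚ.<-≤-trans (ℕₚ.≤-trans (s≤s z≤n) 2≤d) (subst (d ≤_) a+d≡0 (ℕₚ.m≤n+m d a)))
    spread⇒¬CycleEdge a b d 2≤d 2+d≤K (inj₂ b+K≡a+d) (inj₁ refl) =
      ℕₚ.<-irrefl (sym (ℕₚ.+-cancelˡ-≡ a (suc K) d (trans (ℕₚ.+-suc a K) b+K≡a+d)))
                  (ℕₚ.<-trans (shorter 2+d≤K) (ℕₚ.n<1+n K))
    spread⇒¬CycleEdge a b d 2≤d 2+d≤K (inj₂ b+K≡a+d) (inj₂ (inj₁ refl)) =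
      ℕₚ.1+n≰n (subst (2 + d ≤_) (ℕₚ.+-cancelˡ-≡ b K (suc d) (trans b+K≡a+d (sym (ℕₚ.+-suc b d)))) 2+d≤K)
    spread⇒¬CycleEdge a b d 2≤d 2+d≤K (inj₂ b+K≡a+d) (inj₂ (inj₂ (inj₁ (refl , _)))) =
      ℕₚ.<⇒≱ (shorter 2+d≤K) (subst (K ≤_) b+K≡a+d (ℕₚ.m≤n+m K b))
    spread⇒¬CycleEdge a b d 2≤d 2+d≤K (inj₂ b+K≡a+d) (inj₂ (inj₂ (inj₂ (refl , 1+a≡K)))) =
      1≢d 2≤d (ℕₚ.+-cancelˡ-≡ a 1 d (trans (ℕₚ.+-comm a 1) (trans 1+a≡K b+K≡a+d)))

  isInducedCycle : IsInducedCycle cycle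
  isInducedCycle = record
    { periodic = periodic
    ; step~ = step~
    ; chordless = λ i d 2≤d 2+d≤K i~i+d → spread⇒¬CycleEdge (i % K) ((i + d) % K) d 2≤d 2+d≤K
                    (+-%-cases i d (shorter 2+d≤K)) (~⇒CycleEdge i (i + d) i~i+d)
    ; injective = injective
    }
    where
    injective : ∀ i d → 1 ≤ d → d < K → cycle i ≢ cycle (i + d)
    injective i d 1≤d d<K eq with +-%-cases i d d<K
    ... | inj₁ (_ , i+d≡)
      with ℕₚ.+-cancelˡ-≡ (i % K) 0 d (trans (ℕₚ.+-identityʳ (i % K)) (trans (≡⇒%≡ i (i + d) eq) i+d≡))
    ...   | refl with 1≤d
    ...     | ()
    injective i d 1≤d d<K eq | inj₂ i+d+K≡ =
      ℕₚ.<-irrefl (sym (ℕₚ.+-cancelˡ-≡ (i % K) K d (trans (cong (_+ K) (≡⇒%≡ i (i + d) eq)) i+d+K≡))) d<K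

module Neighbours (G : Graph) (p K₁ : ℕ) (claw-free : G Free Claw) (B1-free : G Free B1 p)
                  (2≤p : 2 ≤ p) (long : 2 * p + 3 ≤ suc K₁) where
  open GraphFacts G
  open InducedCycle G K₁

  3+2p≤K : 3 + (p + p) ≤ K
  3+2p≤K = subst (_≤ K) (double p) long
    where
    double : ∀ p → 2 * p + 3 ≡ 3 + (p + p)
    double = solve-∀

  p+5≤K : p + 5 ≤ K
  p+5≤K = ℕₚ.≤-trans (subst (_≤ 3 + (p + p)) (ℕₚ.+-comm 5 p) (s≤s (s≤s (s≤s (ℕₚ.+-monoˡ-≤ p 2≤p))))) 3+2p≤K

  7≤K : 7 ≤ K
  7≤K = ℕₚ.≤-trans (ℕₚ.+-monoˡ-≤ 5 2≤p) p+5≤K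

  ≤K : ∀ {m} → m ≤ 7 → m ≤ K
  ≤K m≤7 = ℕₚ.≤-trans m≤7 7≤K

  <K : ∀ {m} → m < 7 → m < K
  <K m<7 = ℕₚ.<-≤-trans m<7 7≤K

  +p<K : ∀ {s} m → m ≤ 5 → s < p → m + s < K
  +p<K {s} m m≤5 s<p = ℕₚ.≤-trans (ℕₚ.+-monoʳ-< m s<p)
                         (ℕₚ.≤-trans (subst (m + p ≤_) (ℕₚ.+-comm 5 p) (ℕₚ.+-monoˡ-≤ p m≤5)) p+5≤K)

  no-claw : ∀ {z a b c} → z ~ a → z ~ b → z ~ c → a ≁ b → a ≁ c → b ≁ c
          → a ≢ b → a ≢ c → b ≢ c → ⊥
  no-claw za zb zc ab ac bc a≢b a≢c b≢c = claw-free (claw⊑ za zb zc ab ac bc a≢b a≢c b≢c)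

  module OffCycle {c : ℕ → V} (cyc : IsInducedCycle c) (y : V) (y∉c : ∀ i → y ≢ c i) where
    open IsInducedCycle cyc

    c₁≁c₋₁ : c 1 ≁ c K₁
    c₁≁c₋₁ = nonadjacent cyc 1 K₁ (ℕ.s≤s⁻¹ (<K ≤-lit)) ℕₚ.≤-refl

    ~c₀⇒~c₋₁⊎~c₁ : y ~ c 0 → y ~ c K₁ ⊎ y ~ c 1
    ~c₀⇒~c₋₁⊎~c₁ y~c₀ with dec G y (c K₁) | dec G y (c 1)
    ... | yes y~c₋₁ | _ = inj₁ y~c₋₁
    ... | no _ | yes y~c₁ = inj₂ y~c₁
    ... | no y≁c₋₁ | no y≁c₁ =
      ⊥-elim (no-claw (predecessor~ cyc) (step~ 0) (~-sym y~c₀) (≁-sym c₁≁c₋₁) (≁-sym y≁c₋₁) (≁-sym y≁c₁)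
                      (λ e → distinct cyc 1 K₁ (ℕ.s≤s⁻¹ (<K ≤-lit)) (s≤s (ℕₚ.n≤1+n K₁)) (sym e))
                      (λ e → y∉c K₁ (sym e)) (λ e → y∉c 1 (sym e)))

    ¬three-apart : ∀ i j k → 2 + i ≤ j → 2 + j ≤ k → 2 + k ≤ i + K → y ~ c i → y ~ c j → y ~ c k → ⊥
    ¬three-apart i j k 2+i≤j 2+j≤k 2+k≤i+K y~cᵢ y~cⱼ y~cₖ =
      no-claw y~cᵢ y~cⱼ y~cₖ
        (nonadjacent cyc i j 2+i≤j 2+j≤i+K) (nonadjacent cyc i k 2+i≤k 2+k≤i+K) (nonadjacent cyc j k 2+j≤k 2+k≤j+K)
        (distinct cyc i j (lower 2+i≤j) (lower 2+j≤i+K)) (distinct cyc i k (lower 2+i≤k) (lower 2+k≤i+K))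
        (distinct cyc j k (lower 2+j≤k) (lower 2+k≤j+K))
      where
      lower : ∀ {a b} → 2 + a ≤ b → a < b
      lower = ℕₚ.≤-trans (ℕₚ.n≤1+n _)
      2+j≤i+K : 2 + j ≤ i + K
      2+j≤i+K = ℕₚ.≤-trans 2+j≤k (ℕₚ.≤-trans (ℕₚ.m≤n+m k 2) 2+k≤i+K)
      2+i≤k : 2 + i ≤ k
      2+i≤k = ℕₚ.≤-trans 2+i≤j (ℕₚ.≤-trans (ℕₚ.m≤n+m j 2) 2+j≤k)
      2+k≤j+K : 2 + k ≤ j + K
      2+k≤j+K = ℕₚ.≤-trans 2+k≤i+K (ℕₚ.+-monoˡ-≤ K (ℕₚ.≤-trans (ℕₚ.m≤n+m i 2) 2+i≤j))

    -- Triangle c₀ y c₁, pendant c₋₁ at c₀, and the path y c₃ c₄ … c₍ₚ₊₂₎.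
    ¬four-consecutive : y ~ c 0 → y ~ c 1 → y ~ c 2 → y ~ c 3 → ⊥
    ¬four-consecutive y~c₀ y~c₁ y~c₂ y~c₃ = B1-free (B1⊑ record
      { t₀ = c 0 ; t₁ = y ; t₂ = c 1 ; q = c K₁ ; path = λ s → c (3 + s)
      ; t₀~t₁ = ~-sym y~c₀ ; t₀~t₂ = step~ 0 ; t₁~t₂ = y~c₁ ; t₀~q = predecessor~ cyc ; t₁~path = y~c₃
      ; path~path = λ s _ → step~ (3 + s)
      ; q≁t₁ = ≁-sym y≁c₋₁ ; q≁t₂ = ≁-sym c₁≁c₋₁
      ; q≁path = λ s s<p → ≁-sym (nonadjacent cyc (3 + s) K₁ (ℕ.s≤s⁻¹ (+p<K 5 ≤-lit s<p))
                                                             (s≤s (ℕₚ.m≤n+m K (2 + s))))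
      ; t₀≁path = λ s s<p → nonadjacent cyc 0 (3 + s) ≤-lit (ℕₚ.<⇒≤ (+p<K 5 ≤-lit s<p))
      ; t₂≁path = λ s s<p → nonadjacent cyc 1 (3 + s) ≤-lit
                              (ℕₚ.≤-trans (ℕₚ.<⇒≤ (+p<K 5 ≤-lit s<p)) (ℕₚ.n≤1+n K))
      ; t₁≁path = y≁c₄₊
      ; path-induced = λ s t 1+s<t t<p → nonadjacent cyc (3 + s) (3 + t) (s≤s (s≤s (s≤s 1+s<t)))
                                           (ℕₚ.≤-trans (ℕₚ.<⇒≤ (+p<K 5 ≤-lit t<p)) (ℕₚ.m≤n+m K (3 + s)))
      })
      where
      y≁c₋₁ : y ≁ c K₁
      y≁c₋₁ = ¬three-apart 1 3 K₁ ℕₚ.≤-refl (ℕ.s≤s⁻¹ (<K ≤-lit)) ℕₚ.≤-refl y~c₁ y~c₃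
      y≁c₄₊ : ∀ s → suc s < p → y ≁ c (3 + suc s)
      y≁c₄₊ s 1+s<p = ¬three-apart 0 2 (4 + s) ≤-lit ≤-lit (+p<K 4 ≤-lit 1+s<p) y~c₀ y~c₂

    -- Triangle c₀ c₁ y, pendant c₋₁ at c₀, and the path c₁ c₂ … c₍ₚ₊₁₎.
    ¬edge-with-free-run : y ~ c 0 → y ~ c 1 → y ≁ c K₁ → (∀ s → s < p → y ≁ c (2 + s)) → ⊥
    ¬edge-with-free-run y~c₀ y~c₁ y≁c₋₁ y≁run = B1-free (B1⊑ record
      { t₀ = c 0 ; t₁ = c 1 ; t₂ = y ; q = c K₁ ; path = λ s → c (2 + s)
      ; t₀~t₁ = step~ 0 ; t₀~t₂ = ~-sym y~c₀ ; t₁~t₂ = ~-sym y~c₁ ; t₀~q = predecessor~ cyc ; t₁~path = step~ 1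
      ; path~path = λ s _ → step~ (2 + s)
      ; q≁t₁ = ≁-sym c₁≁c₋₁ ; q≁t₂ = ≁-sym y≁c₋₁
      ; q≁path = λ s s<p → ≁-sym (nonadjacent cyc (2 + s) K₁ (ℕ.s≤s⁻¹ (+p<K 4 ≤-lit s<p))
                                    (s≤s (s≤s (ℕₚ.≤-trans (ℕₚ.n≤1+n K₁) (ℕₚ.m≤n+m K s)))))
      ; t₀≁path = λ s s<p → nonadjacent cyc 0 (2 + s) ≤-lit (ℕₚ.<⇒≤ (+p<K 4 ≤-lit s<p))
      ; t₂≁path = y≁run
      ; t₁≁path = λ s s<p → nonadjacent cyc 1 (3 + s) ≤-lit
                              (ℕₚ.≤-trans (ℕₚ.<⇒≤ (+p<K 4 ≤-lit s<p)) (ℕₚ.n≤1+n K))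
      ; path-induced = λ s t 1+s<t t<p → nonadjacent cyc (2 + s) (2 + t) (s≤s (s≤s 1+s<t))
                                           (ℕₚ.≤-trans (ℕₚ.<⇒≤ (+p<K 4 ≤-lit t<p)) (ℕₚ.m≤n+m K (2 + s)))
      })

  least-or-none : (Q : ℕ → Set) → (∀ s → Dec (Q s)) → ∀ m →
                  (∀ s → s < m → ¬ Q s) ⊎ Σ ℕ (λ j → j < m × Q j × (∀ s → s < j → ¬ Q s))
  least-or-none Q Q? zero = inj₁ (λ s ())
  least-or-none Q Q? (suc m) with least-or-none Q Q? m
  ... | inj₂ (j , j<m , Qj , below) = inj₂ (j , ℕₚ.m<n⇒m<1+n j<m , Qj , below)
  ... | inj₁ none with Q? m
  ...   | yes Qm = inj₂ (m , ℕₚ.≤-refl , Qm , none)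
  ...   | no ¬Qm = inj₁ (λ s s<1+m → [ none s , (λ { refl → ¬Qm }) ]′ (ℕₚ.m≤n⇒m<n∨m≡n (ℕ.s≤s⁻¹ s<1+m)))

  -- The first neighbour c_J of y after c₁ has y ~ c_(J+1) and y ≁ c_(J-1), and by the
  -- claw condition at y (with c₀ and c_J) y misses c_(J+2), …, c_(J+p+1): the edge
  -- c_J c_(J+1) has a free run.
  edge-neighbour-extends : ∀ {c} (cyc : IsInducedCycle c) y (y∉c : ∀ i → y ≢ c i) →
                           y ~ c 0 → y ~ c 1 → y ≁ c K₁ → y ≁ c 2 → ⊥
  edge-neighbour-extends {c} cyc y y∉c y~c₀ y~c₁ y≁c₋₁ y≁c₂
    with least-or-none (λ s → y ~ c (2 + s)) (λ s → dec G y _) p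
  ... | inj₁ none = OffCycle.¬edge-with-free-run cyc y y∉c y~c₀ y~c₁ y≁c₋₁ none
  ... | inj₂ (zero , _ , y~c₂ , _) = y≁c₂ y~c₂
  ... | inj₂ (suc j , j<p , y~cⱼ , before) =
    OffCycle.¬edge-with-free-run cycᴶ y (λ i → y∉c (i + J)) y~cⱼ y~cⱼ₊₁ y≁cⱼ₋₁ y≁run
    where
    open IsInducedCycle cyc
    J : ℕ
    J = 3 + j
    cycᴶ : IsInducedCycle (rotate J c)
    cycᴶ = rotate-isInducedCycle J cyc
    y≁cⱼ₋₁ : y ≁ c (K₁ + J)
    y≁cⱼ₋₁ y~ = before j (ℕₚ.n<1+n j) (subst (y ~_) (trans (cong c (unwind j K₁)) (periodic (2 + j))) y~)
      where
      unwind : ∀ j K₁ → K₁ + (3 + j) ≡ (2 + j) + suc K₁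
      unwind = solve-∀
    y~cⱼ₊₁ : y ~ c (suc J)
    y~cⱼ₊₁ = [ (λ y~ → ⊥-elim (y≁cⱼ₋₁ y~)) , (λ y~ → y~) ]′
               (OffCycle.~c₀⇒~c₋₁⊎~c₁ cycᴶ y (λ i → y∉c (i + J)) y~cⱼ)
    y≁run : ∀ s → s < p → y ≁ c ((2 + s) + J)
    y≁run s s<p y~ with (2 + ((2 + s) + J)) ℕ.≤? K
    ... | yes fits = OffCycle.¬three-apart cyc y y∉c 0 J ((2 + s) + J) ≤-lit (ℕₚ.+-monoˡ-≤ J (ℕₚ.m≤m+n 2 s)) fits
                                             y~c₀ y~cⱼ y~
    ... | no ¬fits = y≁c₋₁ (subst (λ i → y ~ c i) (ℕₚ.≤-antisym ≤K₁ (ℕ.s≤s⁻¹ (ℕ.s≤s⁻¹ (ℕₚ.≰⇒> ¬fits))))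
                                  y~)
      where
      ≤K₁ : (2 + s) + J ≤ K₁
      ≤K₁ = subst (_≤ K₁) (sym (regroup s j))
              (ℕ.s≤s⁻¹ (ℕₚ.≤-trans (s≤s (s≤s (s≤s (ℕₚ.+-mono-≤ s<p j<p)))) 3+2p≤K))
        where
        regroup : ∀ s j → (2 + s) + (3 + j) ≡ 2 + (suc s + suc (suc j))
        regroup = solve-∀

  record Sees₀₁₂ (y : V) (c : ℕ → V) : Set where
    field
      y~c₀ : y ~ c 0
      y~c₁ : y ~ c 1
      y~c₂ : y ~ c 2
      y≁rest : ∀ d → 3 ≤ d → d < K → y ≁ c d

  sees₀₁₂ : ∀ {c} (cyc : IsInducedCycle c) y (y∉c : ∀ i → y ≢ c i)
          → y ~ c 0 → y ~ c 1 → y ~ c 2 → Sees₀₁₂ y c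
  sees₀₁₂ {c} cyc y y∉c y~c₀ y~c₁ y~c₂ =
    record { y~c₀ = y~c₀ ; y~c₁ = y~c₁ ; y~c₂ = y~c₂ ; y≁rest = y≁rest }
    where
    open OffCycle cyc y y∉c
    y≁rest : ∀ d → 3 ≤ d → d < K → y ≁ c d
    y≁rest d 3≤d d<K y~c with (2 + d) ℕ.≤? K | d ℕ.≟ 3
    ... | _ | yes refl = ¬four-consecutive y~c₀ y~c₁ y~c₂ y~c
    ... | yes fits | no d≢3 =
      ¬three-apart 0 2 d ℕₚ.≤-refl (ℕₚ.≤∧≢⇒< 3≤d (λ e → d≢3 (sym e))) fits y~c₀ y~c₂ y~c
    ... | no ¬fits | no _ with ℕₚ.≤-antisym (ℕ.s≤s⁻¹ d<K) (ℕ.s≤s⁻¹ (ℕ.s≤s⁻¹ (ℕₚ.≰⇒> ¬fits)))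
    ...   | refl = OffCycle.¬four-consecutive (shift-back cyc) y (λ i → y∉c (i + K₁)) y~c
                     (subst (y ~_) (sym (wrap cyc 0)) y~c₀) (subst (y ~_) (sym (wrap cyc 1)) y~c₁)
                     (subst (y ~_) (sym (wrap cyc 2)) y~c₂)

  record SeesConsecutiveTriple (y : V) : Set where
    field
      cycle : ℕ → V
      isInducedCycle : IsInducedCycle cycle
      y∉cycle : ∀ i → y ≢ cycle i
      sees : Sees₀₁₂ y cycle

  sees-from-first : ∀ {c} (cyc : IsInducedCycle c) y (y∉c : ∀ i → y ≢ c i) → y ~ c 0 → y ≁ c K₁
                  → SeesConsecutiveTriple y
  sees-from-first {c} cyc y y∉c y~c₀ y≁c₋₁ with OffCycle.~c₀⇒~c₋₁⊎~c₁ cyc y y∉c y~c₀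
  ... | inj₁ y~c₋₁ = ⊥-elim (y≁c₋₁ y~c₋₁)
  ... | inj₂ y~c₁ with dec G y (c 2)
  ...   | yes y~c₂ = record
    { cycle = c ; isInducedCycle = cyc ; y∉cycle = y∉c ; sees = sees₀₁₂ cyc y y∉c y~c₀ y~c₁ y~c₂ }
  ...   | no y≁c₂ = ⊥-elim (edge-neighbour-extends cyc y y∉c y~c₀ y~c₁ y≁c₋₁ y≁c₂)

  -- Walk backwards along the cycle until the first non-neighbour; by
  -- ¬four-consecutive this takes at most three steps.
  sees-consecutive-triple : ∀ {c} (cyc : IsInducedCycle c) y (y∉c : ∀ i → y ≢ c i) → y ~ c 0
                          → SeesConsecutiveTriple y
  sees-consecutive-triple {c} cyc y y∉c y~c₀ with dec G y (c K₁)
  ... | no y≁c₋₁ = sees-from-first cyc y y∉c y~c₀ y≁c₋₁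
  ... | yes y~c₋₁ with dec G y (c (K₁ + K₁))
  ...   | no y≁c₋₂ = sees-from-first (shift-back cyc) y (λ i → y∉c (i + K₁)) y~c₋₁ y≁c₋₂
  ...   | yes y~c₋₂ with dec G y (c (K₁ + K₁ + K₁))
  ...     | no y≁c₋₃ = sees-from-first (shift-back (shift-back cyc)) y (λ i → y∉c (i + K₁ + K₁)) y~c₋₂ y≁c₋₃
  ...     | yes y~c₋₃ = ⊥-elim (OffCycle.¬four-consecutive cyc³ y (λ i → y∉c (i + K₁ + K₁ + K₁)) y~c₋₃
                          (subst (y ~_) (sym (wrap cyc² 0)) y~c₋₂)
                          (subst (y ~_) (sym (trans (wrap cyc² 1) (wrap cyc¹ 0))) y~c₋₁)
                          (subst (y ~_) (sym (trans (wrap cyc² 2) (trans (wrap cyc¹ 1) (wrap cyc 0)))) y~c₀))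
    where
    cyc¹ : IsInducedCycle (rotate K₁ c)
    cyc¹ = shift-back cyc
    cyc² : IsInducedCycle (rotate K₁ (rotate K₁ c))
    cyc² = shift-back cyc¹
    cyc³ : IsInducedCycle (rotate K₁ (rotate K₁ (rotate K₁ c)))
    cyc³ = shift-back cyc²

  module Reflect₂ {c : ℕ → V} (cyc : IsInducedCycle c) where
    open IsInducedCycle cyc

    c′ : ℕ → V
    c′ = reflect 2 c

    c′₁ : c′ 1 ≡ c 1
    c′₁ = trans (cong (λ j → c (2 + j)) (ℕₚ.+-identityʳ K₁)) (periodic 1)

    c′₂ : c′ 2 ≡ c 0
    c′₂ = trans (cong c (twice K₁)) (periodic* cyc 0 2)
      where
      twice : ∀ K₁ → 2 + 2 * K₁ ≡ 0 + 2 * suc K₁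
      twice = solve-∀

    sees₀₁₂-reflect : ∀ {x} → Sees₀₁₂ x c → Sees₀₁₂ x c′
    sees₀₁₂-reflect {x} s = record
      { y~c₀ = y~c₂ ; y~c₁ = subst (x ~_) (sym c′₁) y~c₁ ; y~c₂ = subst (x ~_) (sym c′₂) y~c₀
      ; y≁rest = x≁rest }
      where
      open Sees₀₁₂ s
      x≁rest : ∀ d → 3 ≤ d → d < K → x ≁ c′ d
      x≁rest (suc d₀) 3≤d d<K with ℕₚ.m≤n⇒∃[o]m+o≡n (ℕₚ.<⇒≤ d<K)
      ... | zero , d+0≡K = ⊥-elim (ℕₚ.<-irrefl (trans (sym (ℕₚ.+-identityʳ (suc d₀))) d+0≡K) d<K)
      ... | suc d″ , split = subst (x ≁_) (sym (reflect-backwards cyc 2 d₀ (suc d″) split 0))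
            (y≁rest (3 + d″) ≤-lit (subst (3 + d″ <_) split (ℕₚ.+-monoˡ-≤ (suc d″) 3≤d)))

  module AroundTriple {c : ℕ → V} (cyc : IsInducedCycle c) (x : V) (x∉c : ∀ i → x ≢ c i) (sx : Sees₀₁₂ x c) where
    open IsInducedCycle cyc
    open Sees₀₁₂ sx renaming (y~c₀ to x~c₀; y~c₁ to x~c₁; y~c₂ to x~c₂; y≁rest to x≁rest)

    4+s<K : ∀ {s} → s < p → 4 + s < K
    4+s<K = +p<K 4 ≤-lit

    5+s<K : ∀ {s} → s < p → 5 + s < K
    5+s<K = +p<K 5 ≤-lit

    cyc¹ : IsInducedCycle (rotate 1 c)
    cyc¹ = rotate-isInducedCycle 1 cyc

    cyc² : IsInducedCycle (rotate 2 c)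
    cyc² = rotate-isInducedCycle 2 cyc

    cK₁+1≡c₀ : c (K₁ + 1) ≡ c 0
    cK₁+1≡c₀ = trans (cong c (ℕₚ.+-comm K₁ 1)) (periodic 0)

    cK₁+2≡c₁ : c (K₁ + 2) ≡ c 1
    cK₁+2≡c₁ = trans (cong c (ℕₚ.+-comm K₁ 2)) (wrap cyc 1)

    -- If w sees c₁ c₂ c₃, the triangle c₂ c₃ w with pendant x at c₂ and path c₃ c₄ … is a B₁,ₚ.
    ¬non-neighbour-sees-c₁c₂ : ∀ w → (∀ i → w ≢ c i) → x ≁ w → w ~ c 1 → w ~ c 2 → w ≁ c 0 → ⊥
    ¬non-neighbour-sees-c₁c₂ w w∉c x≁w w~c₁ w~c₂ w≁c₀ with dec G w (c 3)
    ... | no w≁c₃ = edge-neighbour-extends cyc¹ w (λ i → w∉c (i + 1)) w~c₁ w~c₂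
                      (λ w~ → w≁c₀ (subst (w ~_) cK₁+1≡c₀ w~)) w≁c₃
    ... | yes w~c₃ = B1-free (B1⊑ record
      { t₀ = c 2 ; t₁ = c 3 ; t₂ = w ; q = x ; path = λ s → c (4 + s)
      ; t₀~t₁ = step~ 2 ; t₀~t₂ = ~-sym w~c₂ ; t₁~t₂ = ~-sym w~c₃ ; t₀~q = ~-sym x~c₂ ; t₁~path = step~ 3
      ; path~path = λ s _ → step~ (4 + s)
      ; q≁t₁ = x≁rest 3 ℕₚ.≤-refl (<K ≤-lit) ; q≁t₂ = x≁w
      ; q≁path = λ s s<p → x≁rest (4 + s) ≤-lit (4+s<K s<p)
      ; t₀≁path = λ s s<p → nonadjacent cyc 2 (4 + s) ≤-lit (s≤s (s≤s (ℕₚ.<⇒≤ (4+s<K s<p))))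
      ; t₂≁path = λ s s<p → subst (λ i → w ≁ c i) (ℕₚ.+-comm (3 + s) 1)
                              (w≁rest (3 + s) ≤-lit (ℕₚ.<-trans (ℕₚ.n<1+n _) (4+s<K s<p)))
      ; t₁≁path = λ s s<p → nonadjacent cyc 3 (5 + s) ≤-lit
                              (s≤s (s≤s (s≤s (ℕₚ.≤-trans (ℕₚ.n≤1+n _) (ℕₚ.<⇒≤ (4+s<K s<p))))))
      ; path-induced = λ s t 1+s<t t<p → nonadjacent cyc (4 + s) (4 + t) (s≤s (s≤s (s≤s (s≤s 1+s<t))))
                                           (ℕₚ.≤-trans (s≤s (4+s<K t<p)) (s≤s (ℕₚ.m≤n+m K (3 + s))))
      })
      where
      w≁rest : ∀ d → 3 ≤ d → d < K → w ≁ c (d + 1)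
      w≁rest = Sees₀₁₂.y≁rest (sees₀₁₂ cyc¹ w (λ i → w∉c (i + 1)) w~c₁ w~c₂ w~c₃)

    -- w must see c₂ c₃ c₄, and then the triangle x w c₂ with pendant c₀ at x and
    -- path w c₄ c₅ … is a B₁,ₚ.
    ¬neighbour-sees-c₂-not-c₁ : ∀ w → (∀ i → w ≢ c i) → x ~ w → w ≁ c 1 → w ~ c 2 → ⊥
    ¬neighbour-sees-c₂-not-c₁ w w∉c x~w w≁c₁ w~c₂
      with OffCycle.~c₀⇒~c₋₁⊎~c₁ cyc² w (λ i → w∉c (i + 2)) w~c₂
    ... | inj₁ w~ = w≁c₁ (subst (w ~_) cK₁+2≡c₁ w~)
    ... | inj₂ w~c₃ with dec G w (c 4)
    ...   | no w≁c₄ = edge-neighbour-extends cyc² w (λ i → w∉c (i + 2)) w~c₂ w~c₃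
                        (λ w~ → w≁c₁ (subst (w ~_) cK₁+2≡c₁ w~)) w≁c₄
    ...   | yes w~c₄ = B1-free (B1⊑ record
      { t₀ = x ; t₁ = w ; t₂ = c 2 ; q = c 0 ; path = λ s → c (4 + s)
      ; t₀~t₁ = x~w ; t₀~t₂ = x~c₂ ; t₁~t₂ = w~c₂ ; t₀~q = x~c₀ ; t₁~path = w~c₄
      ; path~path = λ s _ → step~ (4 + s)
      ; q≁t₁ = ≁-sym w≁c₀ ; q≁t₂ = nonadjacent cyc 0 2 ℕₚ.≤-refl (≤K ≤-lit)
      ; q≁path = λ s s<p → nonadjacent cyc 0 (4 + s) ≤-lit (5+s<K s<p)
      ; t₀≁path = λ s s<p → x≁rest (4 + s) ≤-lit (4+s<K s<p)
      ; t₂≁path = λ s s<p → nonadjacent cyc 2 (4 + s) ≤-lit (s≤s (s≤s (ℕₚ.<⇒≤ (4+s<K s<p))))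
      ; t₁≁path = λ s s<p → subst (λ i → w ≁ c i) (ℕₚ.+-comm (3 + s) 2)
                              (w≁rest (3 + s) ≤-lit (ℕₚ.<-trans (ℕₚ.n<1+n _) (4+s<K (ℕₚ.<-trans (ℕₚ.n<1+n s) s<p))))
      ; path-induced = λ s t 1+s<t t<p → nonadjacent cyc (4 + s) (4 + t) (s≤s (s≤s (s≤s (s≤s 1+s<t))))
                                           (ℕₚ.≤-trans (s≤s (4+s<K t<p)) (s≤s (ℕₚ.m≤n+m K (3 + s))))
      })
      where
      w≁rest : ∀ d → 3 ≤ d → d < K → w ≁ c (d + 2)
      w≁rest = Sees₀₁₂.y≁rest (sees₀₁₂ cyc² w (λ i → w∉c (i + 2)) w~c₂ w~c₃ w~c₄)
      w≁c₀ : w ≁ c 0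
      w≁c₀ w~c₀ with ℕₚ.m≤n⇒∃[o]m+o≡n (≤K {2} ≤-lit)
      ... | d , 2+d≡K = w≁rest d (ℕ.s≤s⁻¹ (ℕ.s≤s⁻¹ (subst (5 ≤_) (sym 2+d≡K) (≤K ≤-lit))))
                          (subst (d <_) 2+d≡K (s≤s (ℕₚ.n≤1+n d)))
                          (subst (w ~_) (sym (trans (cong c (trans (ℕₚ.+-comm d 2) 2+d≡K)) (periodic 0))) w~c₀)

  on-cycle? : ∀ {c} → IsInducedCycle c → ∀ w → Σ ℕ (λ i → i < K × w ≡ c i) ⊎ (∀ i → w ≢ c i)
  on-cycle? {c} cyc w with least-or-none (λ i → w ≡ c i) (λ i → w Finₚ.≟ c i) K
  ... | inj₂ (i , i<K , w≡cᵢ , _) = inj₁ (i , i<K , w≡cᵢ)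
  ... | inj₁ none = inj₂ (λ i w≡cᵢ → none (i % K) (m%n<n i K) (trans w≡cᵢ c≡c%))
    where
    c≡c% : ∀ {i} → c i ≡ c (i % K)
    c≡c% {i} = trans (cong c (m≡m%n+[m/n]*n i K)) (periodic* cyc (i % K) (i / K))

  module _ {c : ℕ → V} (cyc : IsInducedCycle c) (x : V) (x∉c : ∀ i → x ≢ c i) (sx : Sees₀₁₂ x c) where
    open IsInducedCycle cyc
    open Sees₀₁₂ sx renaming (y~c₀ to x~c₀; y~c₁ to x~c₁; y~c₂ to x~c₂; y≁rest to x≁rest)
    open AroundTriple cyc x x∉c sx
    private
      module R = Reflect₂ cyc
      module AroundReflected =
        AroundTriple (reflect-isInducedCycle 2 cyc) x (λ i → x∉c (2 + i * K₁)) (R.sees₀₁₂-reflect sx)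

    c₁-neighbour⇒x-neighbour : ∀ w → (∀ i → w ≢ c i) → w ≢ x → w ~ c 1 → x ~ w
    c₁-neighbour⇒x-neighbour w w∉c w≢x w~c₁ with dec G x w
    ... | yes x~w = x~w
    ... | no x≁w with dec G w (c 2)
    ...   | yes w~c₂ with dec G w (c 0)
    ...     | yes w~c₀ = ⊥-elim (no-claw (~-sym x~c₂) (~-sym w~c₂) (step~ 2) x≁w (x≁rest 3 ℕₚ.≤-refl (<K ≤-lit))
                           (OffCycle.¬four-consecutive cyc w w∉c w~c₀ w~c₁ w~c₂)
                           (λ e → w≢x (sym e)) (x∉c 3) (w∉c 3))
    ...     | no w≁c₀ = ⊥-elim (¬non-neighbour-sees-c₁c₂ w w∉c x≁w w~c₁ w~c₂ w≁c₀)
    c₁-neighbour⇒x-neighbour w w∉c w≢x w~c₁ | no x≁w | no w≁c₂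
      with OffCycle.~c₀⇒~c₋₁⊎~c₁ cyc¹ w (λ i → w∉c (i + 1)) w~c₁
    ... | inj₂ w~c₂ = ⊥-elim (w≁c₂ w~c₂)
    ... | inj₁ w~cK = ⊥-elim (AroundReflected.¬non-neighbour-sees-c₁c₂ w (λ i → w∉c (2 + i * K₁)) x≁w
                        (subst (w ~_) (sym R.c′₁) w~c₁) (subst (w ~_) (sym R.c′₂) (subst (w ~_) cK₁+1≡c₀ w~cK)) w≁c₂)

    x-neighbour⇒c₁-neighbour : ∀ w → (∀ i → w ≢ c i) → x ~ w → c 1 ~ w
    x-neighbour⇒c₁-neighbour w w∉c x~w with dec G w (c 1)
    ... | yes w~c₁ = ~-sym w~c₁
    ... | no w≁c₁ with dec G w (c 2) | dec G w (c 0)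
    ...   | yes w~c₂ | _ = ⊥-elim (¬neighbour-sees-c₂-not-c₁ w w∉c x~w w≁c₁ w~c₂)
    ...   | no _ | yes w~c₀ = ⊥-elim (AroundReflected.¬neighbour-sees-c₂-not-c₁ w (λ i → w∉c (2 + i * K₁)) x~w
                                (λ w~ → w≁c₁ (subst (w ~_) R.c′₁ w~)) (subst (w ~_) (sym R.c′₂) w~c₀))
    ...   | no w≁c₂ | no w≁c₀ = ⊥-elim (no-claw x~c₀ x~c₂ x~w (nonadjacent cyc 0 2 ℕₚ.≤-refl (≤K ≤-lit))
                                 (≁-sym w≁c₀) (≁-sym w≁c₂) (distinct cyc 0 2 ≤-lit (<K ≤-lit))
                                 (λ e → w∉c 0 (sym e)) (λ e → w∉c 2 (sym e)))

    twins-with-c₁ : Twins x (c 1)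
    twins-with-c₁ = record { x≢v = x∉c 1 ; x~v = x~c₁ ; same-neighbours = same-neighbours }
      where
      same-neighbours : ∀ w → w ≢ x → w ≢ c 1 → x ~ w ⇔ c 1 ~ w
      same-neighbours w w≢x w≢c₁ with on-cycle? cyc w
      ... | inj₂ w∉c = mk⇔ (x-neighbour⇒c₁-neighbour w w∉c)
                           (λ c₁~w → c₁-neighbour⇒x-neighbour w w∉c w≢x (~-sym c₁~w))
      ... | inj₁ (0 , _ , refl) = ⇔-inhabited x~c₀ (~-sym (step~ 0))
      ... | inj₁ (1 , _ , refl) = ⊥-elim (w≢c₁ refl)
      ... | inj₁ (2 , _ , refl) = ⇔-inhabited x~c₂ (step~ 1)
      ... | inj₁ (suc (suc (suc j)) , j+3<K , refl) =
            ⇔-empty (x≁rest (3 + j) ≤-lit j+3<K) (nonadjacent cyc 1 (3 + j) ≤-lit (s≤s j+3<K))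

  attached⇒twins : (e : Cycle K ⊑ᵢ G) → ∀ x → ¬ Image e x → ∀ z → x ~ _⊑ᵢ_.f e z → Σ V (Twins x)
  attached⇒twins e x x∉e z x~z = c 1 , twins-with-c₁ cyc x x∉c sees
    where
    module E = FromEmbedding G K₁ (≤K ≤-lit) e
    x∉E : ∀ i → x ≢ E.cycle i
    x∉E i x≡cᵢ = x∉e (E.index i , sym x≡cᵢ)
    open SeesConsecutiveTriple (sees-consecutive-triple (rotate-isInducedCycle (toℕ z) E.isInducedCycle) x
                                  (λ i → x∉E (i + toℕ z)) (subst (x ~_) (sym (E.cycle-toℕ z)) x~z))
      renaming (cycle to c; isInducedCycle to cyc; y∉cycle to x∉c)

inflation : ∀ p K₁ → 2 ≤ p → 2 * p + 3 ≤ suc K₁ → ∀ m (G : Graph) → n G ≡ m → Connected G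
          → G Free Claw → G Free B1 p → Cycle (suc K₁) ⊑ᵢ G → InflationOf (Cycle (suc K₁)) G
inflation p K₁ 2≤p long zero G refl conn claw-free B1-free e with _⊑ᵢ_.f e fz
... | ()
inflation p K₁ 2≤p long (suc m) G n≡1+m conn claw-free B1-free e with onto-or-attached e conn fz
... | inj₁ onto = base (⊑ᵢ-onto⇒≅ e onto)
... | inj₂ (x , x∉e , z , x~z) =
  step (inflation p K₁ 2≤p long m D.G-x (cong ℕ.pred n≡1+m) (D.connected conn)
                  (Free-deleteVertex x claw-free) (Free-deleteVertex x B1-free) (D.⊑ᵢ-avoiding e x∉e))
       D.v′ D.addTwin≅
  where
  twin : Σ (Fin (n G)) (GraphFacts.Twins G x)
  twin = Neighbours.attached⇒twins G p K₁ claw-free B1-free 2≤p long e x x∉e z x~z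
  module D = DeleteTwin G (proj₂ twin)

mainTheorem5 : (p : ℕ) → 1 < p → (G : Graph) → Connected G
    → G Free Claw → G Free B1 p
    → (k : ℕ) → k ≥ 2 * p + 3 → Cycle k ⊑ᵢ G
    → InflationOf (Cycle k) G
mainTheorem5 p 1<p G conn claw-free B1-free zero k≥ e with ℕₚ.m+n≤o⇒n≤o (2 * p) k≥
... | ()
mainTheorem5 p 1<p G conn claw-free B1-free (suc K₁) k≥ e = inflation p K₁ 1<p k≥ (n G) G refl conn claw-free B1-free e
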